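{- Let $G$ be a graph on vertex set $[n]=\{1,\dots,n\}$ and let $1\le i<j\le n$. If $G$ is $\mathcal{L}_{n,k}$-free, then $S_{ij}(G)$ is also $\mathcal{L}_{n,k}$-free.
   Context: A linear forest is a graph whose connected components are all paths or isolated vertices; $\mathcal{L}_{n,k}$ is the family of all linear forests on $n$ vertices with exactly $k$ edges, and a graph is $\mathcal{L}_{n,k}$-free if it has no subgraph isomorphic to a member of $\mathcal{L}_{n,k}$. For a graph $G$ on $[n]$ (edges viewed as 2-subsets of $[n]$) and $1\le i<j\le n$, the shifting operation $S_{ij}$ on an edge $e\in E(G)$ is defined by $S_{ij}(e)=(e\setminus\{j\})\cup\{i\}$ if $j\in e$, $i\notin e$ and $(e\setminus\{j\})\cup\{i\}\notin E(G)$, and $S_{ij}(e)=e$ otherwise. $S_{ij}(G)$ is the graph on vertex set $[n]$ with edge set $\{S_{ij}(e): e\in E(G)\}$. -}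

module Defs where

open import Data.Nat using (ℕ; _∸_)
open import Data.Fin using (Fin; _<_)
open import Data.List using (List; []; _∷_; length; map; concat)
open import Data.Nat.ListAction using (sum)
open import Data.List.Membership.Propositional using (_∈_)
open import Data.List.Relation.Unary.Unique.Propositional using (Unique)
open import Data.Product using (Σ; ∃; _×_; _,_)
open import Data.Sum using (_⊎_)
open import Relation.Nullary using (¬_)
open import Relation.Binary.PropositionalEquality using (_≡_; _≢_)
open import Function.Definitions using (Injective)

-- A (simple) graph on vertex set [n] = Fin n : a symmetric irreflexive
-- edge relation.  The 2-subset {x,y} is an edge iff Adj x y (iff Adj y x).
record Graph (n : ℕ) : Set₁ where
  field
    Adj     : Fin n → Fin n → Set
    sym     : ∀ {x y} → Adj x y → Adj y x
    irrefl  : ∀ {x} → ¬ Adj x x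
open Graph public

-- For an edge e = {x,y} of G (listed as ordered pair x,y), the condition
-- "j ∈ e, i ∉ e and (e \ {j}) ∪ {i} ∉ E(G)".
Moves : ∀ {n} → Graph n → Fin n → Fin n → Fin n → Fin n → Set
Moves G i j x y =
    (x ≡ j × y ≢ i × ¬ Adj G i y)
  ⊎ (y ≡ j × x ≢ i × ¬ Adj G x i)

-- (a,b) is (an ordering of) S_ij({x,y}) where {x,y} is given as (x,y).
ShiftsTo : ∀ {n} → Graph n → Fin n → Fin n →
           Fin n → Fin n → Fin n → Fin n → Set
ShiftsTo G i j x y a b =
    (x ≡ j × y ≢ i × ¬ Adj G i y × a ≡ i × b ≡ y)
  ⊎ (y ≡ j × x ≢ i × ¬ Adj G x i × a ≡ x × b ≡ i)
  ⊎ (¬ Moves G i j x y × a ≡ x × b ≡ y)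

ShiftAdj : ∀ {n} → Graph n → Fin n → Fin n → Fin n → Fin n → Set
ShiftAdj G i j a b =
  Σ (Fin _) λ x → Σ (Fin _) λ y → Adj G x y × ShiftsTo G i j x y a b

data Consec {A : Set} : List A → A → A → Set where
  here  : ∀ {x y l} → Consec (x ∷ y ∷ l) x y
  there : ∀ {z x y l} → Consec l x y → Consec (z ∷ l) x y

-- A linear forest on vertex set Fin n, presented by its components:
-- a partition of Fin n into paths (each path a list of distinct
-- vertices; an isolated vertex is a one-element path).
record LinearForest (n : ℕ) : Set where
  field
    paths  : List (List (Fin n))
    unique : Unique (concat paths)
    cover  : ∀ v → v ∈ concat paths
open LinearForest public

LFAdj : ∀ {n} → LinearForest n → Fin n → Fin n → Set
LFAdj F x y = Σ (List _) λ p → p ∈ paths F × (Consec p x y ⊎ Consec p y x)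

-- Number of edges: a path on m vertices has m ∸ 1 edges.
numEdges : ∀ {n} → LinearForest n → ℕ
numEdges F = sum (map (λ p → length p ∸ 1) (paths F))

ContainsCopy : ∀ {n} → (Fin n → Fin n → Set) → (Fin n → Fin n → Set) → Set
ContainsCopy {n} E H =
  Σ (Fin n → Fin n) λ φ → Injective _≡_ _≡_ φ ×
    (∀ x y → H x y → E (φ x) (φ y))

LFree : ∀ {n} → ℕ → (Fin n → Fin n → Set) → Set
LFree {n} k E = (F : LinearForest n) → numEdges F ≡ k → ¬ ContainsCopy E (LFAdj F)

module Submission where

-- Write E for the edges of G and S for those of S_ij(G).  Suppose S
-- contains a linear forest with k edges.  Since the copy is an injective,
-- hence bijective, map on [n], S has a *path cover of weight k*: a
-- partition of [n] into vertex-disjoint S-paths with k edges in total.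
-- We turn it into such a cover for E, contradicting L_{n,k}-freeness of G.
-- Three facts about S drive everything: an S-edge avoiding i is an
-- E-edge; an S-edge jz with z ≠ i has iz ∈ E (else it would have been
-- shifted); an S-edge iy is either old (iy ∈ E) or new (jy ∈ E).  Hence
-- only the (at most two) edges at i need care.  If both are old, the
-- cover already lies in E.  If each is new or goes to j, swapping the
-- labels i and j gives an E-cover.  Otherwise (up to reversing i's path)
-- i's path reads A y₁ i y₂ B with y₁ new and y₂ ≠ j old, and a local
-- surgery depending on where j lies (in A, in B, or on another path)
-- produces an E-cover of the same weight.

open import Defs
open import Data.Empty using (⊥; ⊥-elim)
open import Data.Fin using (Fin; zero; suc; _<_; _≟_; punchOut)
open import Data.Fin.Properties using (any?; pigeonhole; punchOut-injective; <⇒≢)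
open import Data.Fin.Permutation.Components using (transpose; transpose-inverse)
open import Data.List using (List; []; _∷_; _++_; [_]; _∷ʳ_; concat; map; length; reverse; InitLast; initLast; _∷ʳ′_)
open import Data.List.Membership.Propositional using (_∈_)
open import Data.List.Membership.Propositional.Properties using (∈-++⁻; ∈-++⁺ʳ; ∈-∃++; ∈-map⁺; ∈-concat⁻′)
open import Data.List.Properties using (++-assoc; map-++; length-map; length-++; concat-map; unfold-reverse; reverse-++)
open import Data.List.Relation.Binary.Permutation.Propositional
  using (_↭_; ↭-refl; ↭-sym; ↭-trans; ↭-reflexive; refl; prep; swap; trans; ↭⇒↭ₛ)
open import Data.List.Relation.Binary.Permutation.Propositional.Properties
  using (All-resp-↭; ∈-resp-↭; ++⁺ˡ; ++⁺ʳ; shift; shifts; ↭-length; ↭-reverse; ∷↭∷ʳ; map⁺)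
import Data.List.Relation.Binary.Permutation.Setoid.Properties as SetoidPermutation
open import Data.List.Relation.Unary.All as All using (All; []; _∷_)
import Data.List.Relation.Unary.All.Properties as All
open import Data.List.Relation.Unary.AllPairs using ([]; _∷_)
open import Data.List.Relation.Unary.Any using (here; there)
open import Data.List.Relation.Unary.Linked as Linked using (Linked; []; [-]; _∷_)
import Data.List.Relation.Unary.Linked.Properties as Linked
open import Data.List.Relation.Unary.Unique.Propositional using (Unique)
import Data.List.Relation.Unary.Unique.Propositional.Properties as Unique
open import Data.Nat using (ℕ; zero; suc; _+_; _∸_)
open import Data.Nat.ListAction using (sum)
open import Data.Nat.ListAction.Properties using (sum-↭)
open import Data.Nat.Properties using (+-suc; n<1+n)
open import Data.Nat.Tactic.RingSolver using (solve-∀)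
open import Data.Product using (∃; ∃₂; _×_; _,_; proj₁; proj₂)
open import Data.Sum using (_⊎_; inj₁; inj₂)
open import Data.Unit using (⊤; tt)
open import Relation.Nullary using (¬_; Dec; yes; no)
open import Relation.Nullary.Decidable using (¬¬-excluded-middle; dec-true; dec-false)
open import Relation.Binary.PropositionalEquality
  using (_≡_; _≢_; refl; cong; cong₂; subst; subst₂; setoid)
import Relation.Binary.PropositionalEquality as ≡

Avoids : {A : Set} → A → List A → Set
Avoids x = All (x ≢_)

reverse-middle : {A : Set} (X : List A) {x : A} (Y : List A) → reverse (X ++ x ∷ Y) ≡ reverse Y ++ x ∷ reverse X
reverse-middle X {x} Y = ≡.trans (reverse-++ X (x ∷ Y))
  (≡.trans (cong (_++ reverse X) (unfold-reverse x Y)) (++-assoc (reverse Y) [ x ] (reverse X)))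

module _ {A : Set} {R : A → A → Set} where

  linked-split : ∀ X {a Y} → Linked R (X ++ a ∷ Y) → Linked R (X ++ [ a ]) × Linked R (a ∷ Y)
  linked-split []           l       = [-] , l
  linked-split (x ∷ [])     (r ∷ l) = r ∷ [-] , l
  linked-split (x ∷ x′ ∷ X) (r ∷ l) = r ∷ proj₁ (linked-split (x′ ∷ X) l) , proj₂ (linked-split (x′ ∷ X) l)

  linked-join : ∀ X {a Y} → Linked R (X ++ [ a ]) → Linked R (a ∷ Y) → Linked R (X ++ a ∷ Y)
  linked-join []           _         l = l
  linked-join (x ∷ [])     (r ∷ [-]) l = r ∷ l
  linked-join (x ∷ x′ ∷ X) (r ∷ l₁)  l = r ∷ linked-join (x′ ∷ X) l₁ l

  linked-bridge : ∀ X {a b Y} → Linked R (X ++ [ a ]) → R a b → Linked R (b ∷ Y) → Linked R ((X ++ [ a ]) ++ b ∷ Y)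
  linked-bridge X {a} {b} {Y} l r l′ = subst (Linked R) (≡.sym (++-assoc X [ a ] (b ∷ Y))) (linked-join X l (r ∷ l′))

  linked-prefix : ∀ X {Y} → Linked R (X ++ Y) → Linked R X
  linked-prefix []           _       = []
  linked-prefix (x ∷ [])     _       = [-]
  linked-prefix (x ∷ x′ ∷ X) (r ∷ l) = r ∷ linked-prefix (x′ ∷ X) l

  linked-last : ∀ X {a b} → Linked R ((X ++ [ a ]) ++ [ b ]) → R a b
  linked-last []           (r ∷ [-])     = r
  linked-last (x ∷ [])     (_ ∷ r ∷ [-]) = r
  linked-last (x ∷ x′ ∷ X) (_ ∷ l)       = linked-last (x′ ∷ X) l

  linked⇒consec : ∀ {p} → Linked R p → ∀ {x y} → Consec p x y → R x y
  linked⇒consec (r ∷ l) here      = r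
  linked⇒consec (r ∷ l) (there c) = linked⇒consec l c

  consec⇒linked : ∀ p → (∀ {x y} → Consec p x y → R x y) → Linked R p
  consec⇒linked []          f = []
  consec⇒linked (x ∷ [])    f = [-]
  consec⇒linked (x ∷ y ∷ p) f = f here ∷ consec⇒linked (y ∷ p) (λ c → f (there c))

  linked-reverse : (∀ {x y} → R x y → R y x) → ∀ {p} → Linked R p → Linked R (reverse p)
  linked-reverse s []      = []
  linked-reverse s [-]     = [-]
  linked-reverse s {x ∷ y ∷ p} (r ∷ l) =
    subst (Linked R) (≡.sym reverse-xyp)
      (linked-join (reverse p) (subst (Linked R) (unfold-reverse y p) (linked-reverse s l)) (s r ∷ [-]))
    where
    reverse-xyp : reverse (x ∷ y ∷ p) ≡ reverse p ++ y ∷ [ x ]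
    reverse-xyp = ≡.trans (unfold-reverse x (y ∷ p))
      (≡.trans (cong (_∷ʳ x) (unfold-reverse y p)) (++-assoc (reverse p) [ y ] [ x ]))

  linked-reverse-stretch : (∀ {x y} → R x y → R y x) → ∀ {x} Z {y} →
                           Linked R (x ∷ Z ++ [ y ]) → Linked R ((y ∷ reverse Z) ++ [ x ])
  linked-reverse-stretch s {x} Z {y} l = subst (Linked R) ends (linked-reverse s l)
    where
    ends : reverse (x ∷ Z ++ [ y ]) ≡ (y ∷ reverse Z) ++ [ x ]
    ends = ≡.trans (reverse-middle [] (Z ++ [ y ])) (cong (_++ [ x ]) (reverse-middle Z []))

linked-avoiding : {A : Set} {R R′ : A → A → Set} {x : A} →
                  (∀ {a b} → R a b → x ≢ a → x ≢ b → R′ a b) →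
                  ∀ {p} → Linked R p → Avoids x p → Linked R′ p
linked-avoiding f []      _                   = []
linked-avoiding f [-]     _                   = [-]
linked-avoiding f (r ∷ l) (xa ∷ av@(xb ∷ _)) = f r xa xb ∷ linked-avoiding f l av

module _ {A : Set} where

  concat-↭ : ∀ {xss yss : List (List A)} → xss ↭ yss → concat xss ↭ concat yss
  concat-↭ refl          = ↭-refl
  concat-↭ (prep x p)    = ++⁺ˡ x (concat-↭ p)
  concat-↭ (swap x y p)  = ↭-trans (shifts x y) (++⁺ˡ y (++⁺ˡ x (concat-↭ p)))
  concat-↭ (trans p q)   = ↭-trans (concat-↭ p) (concat-↭ q)

  unique-↭ : ∀ {xs ys : List A} → xs ↭ ys → Unique xs → Unique ys
  unique-↭ p = SetoidPermutation.Unique-resp-↭ (setoid A) (↭⇒↭ₛ p)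

  unique-middle : ∀ X {x : A} {Y} → Unique (X ++ x ∷ Y) → Avoids x X × Avoids x Y
  unique-middle []      (xY ∷ _) = [] , xY
  unique-middle (z ∷ X) (zXY ∷ u) =
    (λ x≡z → All.lookup zXY (∈-++⁺ʳ X (here refl)) (≡.sym x≡z)) ∷ proj₁ (unique-middle X u) ,
    proj₂ (unique-middle X u)

  focus : ∀ {v : A} xss → v ∈ concat xss → ∃₂ λ Q rest → xss ↭ Q ∷ rest × v ∈ Q
  focus xss v∈ with ∈-concat⁻′ xss v∈
  ... | Q , v∈Q , Q∈xss with ∈-∃++ Q∈xss
  ...   | X , Y , refl = Q , X ++ Y , shift Q X Y , v∈Q

weight : {A : Set} → List (List A) → ℕ
weight ps = sum (map (λ p → length p ∸ 1) ps)

-- For symmetric E this is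
-- precisely a spanning linear forest of E with k edges.
record PathCover {n : ℕ} (k : ℕ) (E : Fin n → Fin n → Set) (ps : List (List (Fin n))) : Set where
  field
    distinct : Unique (concat ps)
    spanning : ∀ v → v ∈ concat ps
    chains   : All (Linked E) ps
    edges    : weight ps ≡ k
open PathCover

module _ {n k : ℕ} where

  rearrange : ∀ {E E′ old new} → PathCover {n} k E old → concat new ↭ concat old →
              weight new ≡ weight old → All (Linked E′) new → PathCover k E′ new
  rearrange c p w l = record
    { distinct = unique-↭ (↭-sym p) (distinct c)
    ; spanning = λ v → ∈-resp-↭ (↭-sym p) (spanning c v)
    ; chains   = l
    ; edges    = ≡.trans w (edges c) }

  reorder : ∀ {E ps qs} → ps ↭ qs → PathCover {n} k E ps → PathCover k E qs
  reorder p c = rearrange c (concat-↭ (↭-sym p))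
    (≡.sym (sum-↭ (map⁺ (λ q → length q ∸ 1) p))) (All-resp-↭ p (chains c))

  reshape-head : ∀ {E E′ P P′ rest} → PathCover {n} k E (P ∷ rest) → P′ ↭ P →
                 Linked E′ P′ → All (Linked E′) rest → PathCover k E′ (P′ ∷ rest)
  reshape-head {rest = rest} c p l ls = rearrange c (++⁺ʳ (concat rest) p)
    (cong (λ m → (m ∸ 1) + weight rest) (↭-length p)) (l ∷ ls)

  exchange-tails : ∀ {E E′} X Y {u v U V rest} →
                   PathCover {n} k E ((X ++ u ∷ U) ∷ (Y ++ v ∷ V) ∷ rest) →
                   Linked E′ (X ++ v ∷ V) → Linked E′ (Y ++ u ∷ U) → All (Linked E′) rest →
                   PathCover k E′ ((X ++ v ∷ V) ∷ (Y ++ u ∷ U) ∷ rest)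
  exchange-tails X Y {u} {v} {U} {V} {rest} c lX lY ls = rearrange c perm same-weight (lX ∷ lY ∷ ls)
    where
    R : List (Fin n)
    R = concat rest
    perm : (X ++ v ∷ V) ++ (Y ++ u ∷ U) ++ R ↭ (X ++ u ∷ U) ++ (Y ++ v ∷ V) ++ R
    perm = subst₂ _↭_
      (≡.sym (≡.trans (++-assoc X (v ∷ V) _) (cong (λ Z → X ++ v ∷ V ++ Z) (++-assoc Y (u ∷ U) R))))
      (≡.sym (≡.trans (++-assoc X (u ∷ U) _) (cong (λ Z → X ++ u ∷ U ++ Z) (++-assoc Y (v ∷ V) R))))
      (++⁺ˡ X (↭-trans (shifts (v ∷ V) Y)
                (↭-trans (++⁺ˡ Y (shifts (v ∷ V) (u ∷ U))) (↭-sym (shifts (u ∷ U) Y)))))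
    path-edges : ∀ (Z : List (Fin n)) {z} Z′ → length (Z ++ z ∷ Z′) ∸ 1 ≡ length Z + length Z′
    path-edges Z Z′ = cong (_∸ 1) (≡.trans (length-++ Z) (+-suc (length Z) (length Z′)))
    reassociate : ∀ x y u v w → (x + v) + ((y + u) + w) ≡ (x + u) + ((y + v) + w)
    reassociate = solve-∀
    same-weight : weight ((X ++ v ∷ V) ∷ (Y ++ u ∷ U) ∷ rest) ≡ weight ((X ++ u ∷ U) ∷ (Y ++ v ∷ V) ∷ rest)
    same-weight rewrite path-edges X {v} V | path-edges Y {u} U | path-edges X {u} U | path-edges Y {v} V =
      reassociate (length X) (length Y) (length U) (length V) (weight rest)

  relabel : ∀ {E E′ ps} (f : Fin n → Fin n) → (∀ {x y} → f x ≡ f y → x ≡ y) → (∀ v → ∃ λ x → f x ≡ v) →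
            PathCover k E ps → All (Linked E′) (map (map f) ps) → PathCover k E′ (map (map f) ps)
  relabel {ps = ps} f injective surjective c l = record
    { distinct = subst Unique (≡.sym (concat-map ps)) (Unique.map⁺ injective (distinct c))
    ; spanning = λ v → subst (_∈ concat (map (map f) ps)) (proj₂ (surjective v))
        (subst (_ ∈_) (≡.sym (concat-map ps)) (∈-map⁺ f (spanning c (proj₁ (surjective v)))))
    ; chains   = l
    ; edges    = ≡.trans (weight-map ps) (edges c) }
    where
    weight-map : ∀ qs → weight (map (map f) qs) ≡ weight qs
    weight-map []       = ≡.refl
    weight-map (q ∷ qs) = cong₂ _+_ (cong (_∸ 1) (length-map f q)) (weight-map qs)

injective⇒surjective : ∀ {n} (f : Fin n → Fin n) → (∀ {x y} → f x ≡ f y → x ≡ y) → ∀ v → ∃ λ x → f x ≡ v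
injective⇒surjective {suc m} f injective v with any? (λ x → f x ≟ v)
... | yes hit = hit
... | no miss with pigeonhole (n<1+n m) (λ x → punchOut {i = v} {j = f x} (λ v≡fx → miss (x , ≡.sym v≡fx)))
...   | x , y , x<y , collide = ⊥-elim (<⇒≢ x<y (injective (punchOut-injective
          (λ v≡fx → miss (x , ≡.sym v≡fx)) (λ v≡fy → miss (y , ≡.sym v≡fy)) collide)))

¬¬-shift : ∀ m {Q : Fin m → Set} → (∀ z → ¬ ¬ Q z) → ¬ ¬ (∀ z → Q z)
¬¬-shift zero    f none = none (λ ())
¬¬-shift (suc m) {Q} f none = f zero (λ q₀ → ¬¬-shift m (λ z → f (suc z)) (λ qs → none (cons q₀ qs)))
  where
  cons : Q zero → (∀ z → Q (suc z)) → ∀ z → Q z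
  cons q₀ qs zero    = q₀
  cons q₀ qs (suc z) = qs z

module _ {n k : ℕ} {E : Fin n → Fin n → Set} where

  -- A copy of a linear forest with k edges in E yields a path cover of
  -- weight k: the copy is a bijection, so the image of the forest's
  -- paths again partitions the vertex set.
  copy⇒cover : (F : LinearForest n) → numEdges F ≡ k → ContainsCopy E (LFAdj F) →
               ∃ λ ps → PathCover k E ps
  copy⇒cover F size (φ , injective , preserves) =
    map (map φ) (paths F) ,
    relabel φ injective (injective⇒surjective φ injective) forest-cover (images (paths F) (chains forest-cover))
    where
    forest-cover : PathCover k (LFAdj F) (paths F)
    forest-cover = record
      { distinct = unique F
      ; spanning = cover F
      ; chains   = All.tabulate (λ {p} p∈F → consec⇒linked p (λ c → p , p∈F , inj₁ c))
      ; edges    = size }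
    images : ∀ ps → All (Linked (LFAdj F)) ps → All (Linked E) (map (map φ) ps)
    images []       []       = []
    images (p ∷ ps) (l ∷ ls) = Linked.map⁺ (Linked.map (λ {x} {y} → preserves x y) l) ∷ images ps ls

  cover⇒¬free : (∀ {x y} → E x y → E y x) → ∀ {ps} → PathCover k E ps → ¬ LFree k E
  cover⇒¬free symmetric {ps} c free = free forest (edges c) ((λ x → x) , (λ eq → eq) , inside)
    where
    forest : LinearForest n
    forest = record { paths = ps ; unique = distinct c ; cover = spanning c }
    inside : ∀ x y → LFAdj forest x y → E x y
    inside x y (p , p∈ps , inj₁ xy) = linked⇒consec (All.lookup (chains c) p∈ps) xy
    inside x y (p , p∈ps , inj₂ yx) = symmetric (linked⇒consec (All.lookup (chains c) p∈ps) yx)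

module Shifted {n : ℕ} (G : Graph n) (i j : Fin n) (i≢j : i ≢ j) (adj? : ∀ z → Dec (Adj G i z)) where

  E S : Fin n → Fin n → Set
  E = Adj G
  S = ShiftAdj G i j

  S-sym : ∀ {a b} → S a b → S b a
  S-sym (x , y , e , inj₁ (x≡j , y≢i , ¬iy , a≡i , b≡y)) =
    y , x , sym G e , inj₂ (inj₁ (x≡j , y≢i , (λ yi → ¬iy (sym G yi)) , b≡y , a≡i))
  S-sym (x , y , e , inj₂ (inj₁ (y≡j , x≢i , ¬xi , a≡x , b≡i))) =
    y , x , sym G e , inj₁ (y≡j , x≢i , (λ ix → ¬xi (sym G ix)) , b≡i , a≡x)
  S-sym (x , y , e , inj₂ (inj₂ (stays , a≡x , b≡y))) =
    y , x , sym G e , inj₂ (inj₂ ((λ m → stays (flip m)) , b≡y , a≡x))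
    where
    flip : Moves G i j y x → Moves G i j x y
    flip (inj₁ (y≡j , x≢i , ¬ix)) = inj₂ (y≡j , x≢i , λ xi → ¬ix (sym G xi))
    flip (inj₂ (x≡j , y≢i , ¬yi)) = inj₁ (x≡j , y≢i , λ iy → ¬yi (sym G iy))

  S-irrefl : ∀ {a} → ¬ S a a
  S-irrefl (x , y , e , inj₁ (_ , y≢i , _ , a≡i , a≡y))        = y≢i (≡.trans (≡.sym a≡y) a≡i)
  S-irrefl (x , y , e , inj₂ (inj₁ (_ , x≢i , _ , a≡x , a≡i))) = x≢i (≡.trans (≡.sym a≡x) a≡i)
  S-irrefl (x , y , e , inj₂ (inj₂ (_ , refl , refl)))        = irrefl G e

  S-away : ∀ {a b} → S a b → i ≢ a → i ≢ b → E a b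
  S-away (x , y , e , inj₁ (_ , _ , _ , a≡i , _))        i≢a _ = ⊥-elim (i≢a (≡.sym a≡i))
  S-away (x , y , e , inj₂ (inj₁ (_ , _ , _ , _ , b≡i))) _ i≢b = ⊥-elim (i≢b (≡.sym b≡i))
  S-away (x , y , e , inj₂ (inj₂ (_ , refl , refl)))     _ _   = e

  -- An S-neighbour y of i is old (iy ∈ G) or new (the shift of jy ∈ G).
  data Neighbour (y : Fin n) : Set where
    old : E i y → Neighbour y
    new : ¬ E i y → E j y → Neighbour y

  neighbour : ∀ {y} → S i y → Neighbour y
  neighbour (x , y , e , inj₁ (refl , _ , ¬iy , _ , refl))    = new ¬iy e
  neighbour (x , y , e , inj₂ (inj₁ (_ , x≢i , _ , refl , _))) = ⊥-elim (x≢i refl)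
  neighbour (x , y , e , inj₂ (inj₂ (_ , refl , refl)))        = old e

  -- The S-edge ij cannot be new (jj is no edge), so it is an edge of G.
  S-ij : S i j → E i j
  S-ij s with neighbour s
  ... | old ij    = ij
  ... | new _ jj  = ⊥-elim (irrefl G jj)

  -- An S-edge jz with z ≠ i survived the shift, which forces iz ∈ G.
  S-from-j : ∀ {z} → S j z → i ≢ z → E i z
  S-from-j (x , y , e , inj₁ (_ , _ , _ , j≡i , _))        _ = ⊥-elim (i≢j (≡.sym j≡i))
  S-from-j (x , y , e , inj₂ (inj₁ (_ , _ , _ , _ , z≡i))) i≢z = ⊥-elim (i≢z (≡.sym z≡i))
  S-from-j {z} (x , y , e , inj₂ (inj₂ (stays , refl , refl))) i≢z with adj? z
  ... | yes iz = iz
  ... | no ¬iz = ⊥-elim (stays (inj₁ (refl , (λ z≡i → i≢z (≡.sym z≡i)) , ¬iz)))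

  τ : Fin n → Fin n
  τ = transpose i j

  τ-i : τ i ≡ j
  τ-i rewrite dec-true (i ≟ i) refl = refl

  τ-j : τ j ≡ i
  τ-j rewrite dec-false (j ≟ i) (λ j≡i → i≢j (≡.sym j≡i)) | dec-true (j ≟ j) refl = refl

  τ-fix : ∀ {x} → i ≢ x → j ≢ x → τ x ≡ x
  τ-fix {x} i≢x j≢x rewrite dec-false (x ≟ i) (λ x≡i → i≢x (≡.sym x≡i))
                          | dec-false (x ≟ j) (λ x≡j → j≢x (≡.sym x≡j)) = refl

  τ-injective : ∀ {x y} → τ x ≡ τ y → x ≡ y
  τ-injective {x} {y} eq =
    ≡.trans (≡.sym (transpose-inverse j i)) (≡.trans (cong (transpose j i) eq) (transpose-inverse j i))

  τ-surjective : ∀ v → ∃ λ x → τ x ≡ v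
  τ-surjective v = transpose j i v , transpose-inverse i j

  τ-edge : ∀ {a b} → S a b → i ≢ a → i ≢ b → E (τ a) (τ b)
  τ-edge {a} {b} s i≢a i≢b with a ≟ j | b ≟ j
  ... | yes refl | yes refl = ⊥-elim (S-irrefl s)
  ... | yes refl | no b≢j   = subst₂ E (≡.sym τ-j) (≡.sym (τ-fix i≢b (λ j≡b → b≢j (≡.sym j≡b)))) (S-from-j s i≢b)
  ... | no a≢j   | yes refl = subst₂ E (≡.sym (τ-fix i≢a (λ j≡a → a≢j (≡.sym j≡a)))) (≡.sym τ-j)
                                (sym G (S-from-j (S-sym s) i≢a))
  ... | no a≢j   | no b≢j   = subst₂ E (≡.sym (τ-fix i≢a (λ j≡a → a≢j (≡.sym j≡a))))
                                (≡.sym (τ-fix i≢b (λ j≡b → b≢j (≡.sym j≡b)))) (S-away s i≢a i≢b)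

  E-distinct : ∀ {x y} → E x y → x ≢ y
  E-distinct e refl = irrefl G e

  avoiding : ∀ {p} → Linked S p → Avoids i p → Linked E p
  avoiding = linked-avoiding S-away

  avoiding-τ : ∀ {p} → Linked S p → Avoids i p → Linked E (map τ p)
  avoiding-τ l av = Linked.map⁺ (linked-avoiding {R′ = λ a b → E (τ a) (τ b)} τ-edge l av)

  all-avoiding : {Q : List (Fin n) → Set} → (∀ {q} → Linked S q → Avoids i q → Q q) →
                 ∀ qs → All (Linked S) qs → Avoids i (concat qs) → All Q qs
  all-avoiding f []       []       _  = []
  all-avoiding f (q ∷ qs) (l ∷ ls) av = f l (All.++⁻ˡ q av) ∷ all-avoiding f qs ls (All.++⁻ʳ q av)

  j-to-i-head : ∀ {X} → Linked S (j ∷ X) → Avoids i X → Linked E (i ∷ X)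
  j-to-i-head [-]     _            = [-]
  j-to-i-head (s ∷ l) av@(i≢z ∷ _) = S-from-j s i≢z ∷ avoiding l av

  j-to-i-last : ∀ C → Linked S (C ++ [ j ]) → Avoids i C → Linked E (C ++ [ i ])
  j-to-i-last []           _         _                     = [-]
  j-to-i-last (c ∷ [])     (s ∷ [-]) (i≢c ∷ [])            = sym G (S-from-j (S-sym s) i≢c) ∷ [-]
  j-to-i-last (c ∷ c′ ∷ C) (s ∷ l)   (i≢c ∷ av@(i≢c′ ∷ _)) = S-away s i≢c i≢c′ ∷ j-to-i-last (c′ ∷ C) l av

  HeadOK : (Fin n → Set) → List (Fin n) → Set
  HeadOK C []      = ⊤
  HeadOK C (b ∷ _) = C b

  LastOK : (Fin n → Set) → List (Fin n) → Set
  LastOK C []          = ⊤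
  LastOK C (a ∷ [])    = C a
  LastOK C (a ∷ b ∷ l) = LastOK C (b ∷ l)

  lastOK-snoc : ∀ {C} X {a} → C a → LastOK C (X ++ [ a ])
  lastOK-snoc []           ca = ca
  lastOK-snoc (x ∷ [])     ca = ca
  lastOK-snoc (x ∷ x′ ∷ X) ca = lastOK-snoc (x′ ∷ X) ca

  keep-right : ∀ {B} → Linked S (i ∷ B) → Avoids i B → HeadOK (E i) B → Linked E (i ∷ B)
  keep-right [-]     _  _  = [-]
  keep-right (_ ∷ l) av iy = iy ∷ avoiding l av

  keep-left : ∀ A → Linked S (A ++ [ i ]) → Avoids i A → LastOK (E i) A → Linked E (A ++ [ i ])
  keep-left []           _         _                     _  = [-]
  keep-left (a ∷ [])     (_ ∷ [-]) _                     ia = sym G ia ∷ [-]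
  keep-left (a ∷ a′ ∷ A) (s ∷ l)   (i≢a ∷ av@(i≢a′ ∷ _)) ok = S-away s i≢a i≢a′ ∷ keep-left (a′ ∷ A) l av ok

  ToJ : Fin n → Set
  ToJ y = y ≡ j ⊎ E j y

  swap-right : ∀ {B} → Linked S (i ∷ B) → Avoids i B → HeadOK ToJ B → Linked E (j ∷ map τ B)
  swap-right [-]     _                _           = [-]
  swap-right (s ∷ l) av               (inj₁ refl) = subst (E j) (≡.sym τ-j) (sym G (S-ij s)) ∷ avoiding-τ l av
  swap-right (s ∷ l) av@(i≢y ∷ _)     (inj₂ jy)   =
    subst (E j) (≡.sym (τ-fix i≢y (E-distinct jy))) jy ∷ avoiding-τ l av

  swap-left : ∀ A → Linked S (A ++ [ i ]) → Avoids i A → LastOK ToJ A → Linked E (map τ A ++ [ j ])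
  swap-left []           _         _          _           = [-]
  swap-left (a ∷ [])     (s ∷ [-]) _          (inj₁ refl) = subst (λ z → E z j) (≡.sym τ-j) (S-ij (S-sym s)) ∷ [-]
  swap-left (a ∷ [])     (s ∷ [-]) (i≢a ∷ []) (inj₂ ja)   =
    subst (λ z → E z j) (≡.sym (τ-fix i≢a (E-distinct ja))) (sym G ja) ∷ [-]
  swap-left (a ∷ a′ ∷ A) (s ∷ l)   (i≢a ∷ av@(i≢a′ ∷ _)) ok = τ-edge s i≢a i≢a′ ∷ swap-left (a′ ∷ A) l av ok

  module _ {k : ℕ} (free : LFree k E) where

    no-cover : ∀ {ps} → PathCover k E ps → ⊥
    no-cover c = cover⇒¬free (sym G) c free

    module Around-i (A B : List (Fin n)) (rest : List (List (Fin n)))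
                    (c : PathCover k S ((A ++ i ∷ B) ∷ rest)) where

      left : Linked S (A ++ [ i ])
      left = proj₁ (linked-split A (All.head (chains c)))

      right : Linked S (i ∷ B)
      right = proj₂ (linked-split A (All.head (chains c)))

      avoids : Avoids i A × Avoids i (B ++ concat rest)
      avoids = unique-middle A (subst Unique (++-assoc A (i ∷ B) (concat rest)) (distinct c))

      avoids-A : Avoids i A
      avoids-A = proj₁ avoids

      avoids-B : Avoids i B
      avoids-B = All.++⁻ˡ B (proj₂ avoids)

      avoids-rest : Avoids i (concat rest)
      avoids-rest = All.++⁻ʳ B (proj₂ avoids)

      rest-in-G : All (Linked E) rest
      rest-in-G = all-avoiding avoiding rest (All.tail (chains c)) avoids-rest

      rest-in-τG : All (Linked E) (map (map τ) rest)
      rest-in-τG = All.map⁺ (all-avoiding {Q = λ q → Linked E (map τ q)} avoiding-τ rest (All.tail (chains c)) avoids-rest)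

    keep-all : ∀ A B rest → PathCover k S ((A ++ i ∷ B) ∷ rest) → LastOK (E i) A → HeadOK (E i) B → ⊥
    keep-all A B rest c okA okB = no-cover (reshape-head c ↭-refl
        (linked-join A (keep-left A left avoids-A okA) (keep-right right avoids-B okB)) rest-in-G)
      where open Around-i A B rest c

    swap-all : ∀ A B rest → PathCover k S ((A ++ i ∷ B) ∷ rest) → LastOK ToJ A → HeadOK ToJ B → ⊥
    swap-all A B rest c okA okB = no-cover (relabel τ τ-injective τ-surjective c
        (subst (Linked E) (≡.sym τ-path)
           (linked-join (map τ A) (swap-left A left avoids-A okA) (swap-right right avoids-B okB))
         ∷ rest-in-τG))
      where
      open Around-i A B rest c
      τ-path : map τ (A ++ i ∷ B) ≡ map τ A ++ j ∷ map τ B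
      τ-path = ≡.trans (map-++ τ A (i ∷ B)) (cong (λ z → map τ A ++ z ∷ map τ B) τ-i)

    -- The remaining case: i's path is A y₁ i y₂ B with y₁ new (jy₁ ∈ G)
    -- and y₂ ≠ j old.  Where j lies decides the surgery.
    module Surgery (A : List (Fin n)) (y₁ y₂ : Fin n) (B : List (Fin n)) (rest : List (List (Fin n)))
                   (c : PathCover k S (((A ++ [ y₁ ]) ++ i ∷ y₂ ∷ B) ∷ rest))
                   (jy₁ : E j y₁) (iy₂ : E i y₂) (y₂≢j : y₂ ≢ j) where

      open Around-i (A ++ [ y₁ ]) (y₂ ∷ B) rest c

      P T : List (Fin n)
      P = (A ++ [ y₁ ]) ++ T
      T = i ∷ y₂ ∷ B

      before : Linked S (A ++ [ y₁ ])
      before = linked-prefix (A ++ [ y₁ ]) left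

      after : Linked E (i ∷ y₂ ∷ B)
      after = keep-right right avoids-B iy₂

      -- j ∈ A, say A = A′ j M: the new path A′ j y₁ (M reversed) i y₂ B,
      -- whose edge next to i in the reversed stretch is jm ∈ S turned into im.
      j-in-A : ∀ A′ M → A ≡ A′ ++ j ∷ M → ⊥
      j-in-A A′ M A≡ = no-cover (reshape-head c perm path rest-in-G)
        where
        stretch : A ++ [ y₁ ] ≡ A′ ++ j ∷ (M ++ [ y₁ ])
        stretch = ≡.trans (cong (_++ [ y₁ ]) A≡) (++-assoc A′ (j ∷ M) [ y₁ ])
        halves : Linked S (A′ ++ [ j ]) × Linked S (j ∷ M ++ [ y₁ ])
        halves = linked-split A′ (subst (Linked S) stretch before)
        avoids′ : Avoids i (A′ ++ j ∷ (M ++ [ y₁ ]))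
        avoids′ = subst (Avoids i) stretch avoids-A
        reversed : Linked E ((y₁ ∷ reverse M) ++ [ i ])
        reversed = linked-reverse-stretch (sym G) M (j-to-i-head (proj₂ halves) (All.tail (All.++⁻ʳ A′ avoids′)))
        path : Linked E (A′ ++ j ∷ y₁ ∷ (reverse M ++ T))
        path = linked-join A′ (avoiding (proj₁ halves) (All.++⁺ (All.++⁻ˡ A′ avoids′) (i≢j ∷ [])))
                 (jy₁ ∷ linked-join (y₁ ∷ reverse M) reversed after)
        perm : A′ ++ j ∷ y₁ ∷ (reverse M ++ T) ↭ P
        perm = ↭-trans (++⁺ˡ A′ (prep j (++⁺ʳ T (↭-trans (prep y₁ (↭-reverse M)) (∷↭∷ʳ y₁ M)))))
                 (↭-reflexive (≡.sym (≡.trans (cong (_++ T) stretch) (++-assoc A′ (j ∷ (M ++ [ y₁ ])) T))))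

      -- j ∈ B, say y₂ B = C j D: the new path A y₁ j (C reversed) i D,
      -- reversing the stretch from i to j and turning jd ∈ S into id.
      j-in-B : ∀ M D → B ≡ M ++ j ∷ D → ⊥
      j-in-B M D B≡ = no-cover (reshape-head c perm path rest-in-G)
        where
        C : List (Fin n)
        C = y₂ ∷ M
        stretch : y₂ ∷ B ≡ C ++ j ∷ D
        stretch = cong (y₂ ∷_) B≡
        halves : Linked S (C ++ [ j ]) × Linked S (j ∷ D)
        halves = linked-split C (subst (Linked S) stretch (Linked.tail right))
        avoids′ : Avoids i (C ++ j ∷ D)
        avoids′ = subst (Avoids i) stretch avoids-B
        reversed : Linked E ((j ∷ reverse C) ++ [ i ])
        reversed = linked-reverse-stretch (sym G) C
                 (iy₂ ∷ avoiding (proj₁ halves) (All.++⁺ (All.++⁻ˡ C avoids′) (i≢j ∷ [])))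
        path : Linked E ((A ++ [ y₁ ]) ++ j ∷ (reverse C ++ i ∷ D))
        path = linked-bridge A (avoiding before avoids-A) (sym G jy₁)
                 (linked-join (j ∷ reverse C) reversed (j-to-i-head (proj₂ halves) (All.tail (All.++⁻ʳ C avoids′))))
        perm : (A ++ [ y₁ ]) ++ j ∷ (reverse C ++ i ∷ D) ↭ P
        perm = ++⁺ˡ (A ++ [ y₁ ])
          (↭-trans (prep j (++⁺ʳ (i ∷ D) (↭-reverse C)))
          (↭-trans (prep j (shift i C D))
          (↭-trans (swap j i ↭-refl)
          (↭-trans (prep i (↭-sym (shift j C D))) (↭-reflexive (cong (i ∷_) (≡.sym stretch)))))))

      -- j lies on another path C j D: exchange the tails after y₁ and
      -- before j, giving the paths A y₁ j D and C i y₂ B.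
      j-elsewhere : ∀ C D rest′ → rest ↭ (C ++ j ∷ D) ∷ rest′ → ⊥
      j-elsewhere C D rest′ p = no-cover (exchange-tails (A ++ [ y₁ ]) C c′ path₁ path₂ rest′-in-G)
        where
        c′ : PathCover k S (P ∷ (C ++ j ∷ D) ∷ rest′)
        c′ = reorder (prep P p) c
        module Around-c′ = Around-i (A ++ [ y₁ ]) (y₂ ∷ B) ((C ++ j ∷ D) ∷ rest′) c′
        avoids-Q : Avoids i (C ++ j ∷ D)
        avoids-Q = All.++⁻ˡ (C ++ j ∷ D) Around-c′.avoids-rest
        halves : Linked S (C ++ [ j ]) × Linked S (j ∷ D)
        halves = linked-split C (All.head (All.tail (chains c′)))
        path₁ : Linked E ((A ++ [ y₁ ]) ++ j ∷ D)
        path₁ = linked-bridge A (avoiding before avoids-A) (sym G jy₁) (avoiding (proj₂ halves) (All.++⁻ʳ C avoids-Q))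
        path₂ : Linked E (C ++ i ∷ y₂ ∷ B)
        path₂ = linked-join C (j-to-i-last C (proj₁ halves) (All.++⁻ˡ C avoids-Q)) after
        rest′-in-G : All (Linked E) rest′
        rest′-in-G = all-avoiding avoiding rest′ (All.tail (All.tail (chains c′)))
                       (All.++⁻ʳ (C ++ j ∷ D) Around-c′.avoids-rest)

      -- j is neither y₁ (jy₁ is an edge), nor i, nor y₂: one of the above.
      j-on-path : j ∈ P → ⊥
      j-on-path j∈P with ∈-++⁻ (A ++ [ y₁ ]) j∈P
      ... | inj₂ (here j≡i)             = i≢j (≡.sym j≡i)
      ... | inj₂ (there (here j≡y₂))    = y₂≢j (≡.sym j≡y₂)
      ... | inj₂ (there (there j∈B))    with ∈-∃++ j∈B
      ...   | M , D , B≡ = j-in-B M D B≡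
      j-on-path j∈P | inj₁ j∈Ay₁ with ∈-++⁻ A j∈Ay₁
      ... | inj₂ (here j≡y₁) = E-distinct jy₁ j≡y₁
      ... | inj₁ j∈A with ∈-∃++ j∈A
      ...   | A′ , M , A≡ = j-in-A A′ M A≡

      j-off-path : j ∈ concat rest → ⊥
      j-off-path j∈rest with focus rest j∈rest
      ... | Q , rest′ , p , j∈Q with ∈-∃++ j∈Q
      ...   | C , D , refl = j-elsewhere C D rest′ p

      impossible : ⊥
      impossible with ∈-++⁻ P (spanning c j)
      ... | inj₁ j∈P    = j-on-path j∈P
      ... | inj₂ j∈rest = j-off-path j∈rest

    data RightEnd : List (Fin n) → Set where
      none : RightEnd []
      next : ∀ {b B} → Neighbour b → RightEnd (b ∷ B)

    data LeftEnd : List (Fin n) → Set where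
      none : LeftEnd []
      prev : ∀ {A a} → Neighbour a → LeftEnd (A ++ [ a ])

    right-end : ∀ {B} → Linked S (i ∷ B) → RightEnd B
    right-end [-]     = none
    right-end (s ∷ _) = next (neighbour s)

    left-end : ∀ A → InitLast A → Linked S (A ++ [ i ]) → LeftEnd A
    left-end .[]            []         _ = none
    left-end .(A′ ++ [ a ]) (A′ ∷ʳ′ a) l = prev (neighbour (S-sym (linked-last A′ l)))

    reverse-i-path : ∀ A′ a b B′ rest → PathCover k S (((A′ ++ [ a ]) ++ i ∷ b ∷ B′) ∷ rest) →
                     PathCover k S (((reverse B′ ++ [ b ]) ++ i ∷ a ∷ reverse A′) ∷ rest)
    reverse-i-path A′ a b B′ rest c = subst (λ Q → PathCover k S (Q ∷ rest)) sides
      (reshape-head c (↭-reverse P) (linked-reverse S-sym (All.head (chains c))) (All.tail (chains c)))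
      where
      P : List (Fin n)
      P = (A′ ++ [ a ]) ++ i ∷ b ∷ B′
      sides : reverse P ≡ (reverse B′ ++ [ b ]) ++ i ∷ a ∷ reverse A′
      sides = ≡.trans (reverse-middle (A′ ++ [ a ]) (b ∷ B′))
                (cong₂ (λ X Y → X ++ i ∷ Y) (unfold-reverse b B′) (reverse-middle A′ []))

    -- The case distinction on the kinds of the (at most two) edges at i:
    -- no new edge, or no old edge to a vertex ≠ j, or else a surgery
    -- (after reversing the path if the new edge lies on the right).
    classify : ∀ A B rest → LeftEnd A → RightEnd B → PathCover k S ((A ++ i ∷ B) ∷ rest) → ⊥
    classify _ _ rest none none c                     = keep-all [] [] rest c tt tt
    classify _ _ rest none (next (old ib)) c          = keep-all [] _ rest c tt ib
    classify _ _ rest none (next (new _ jb)) c        = swap-all [] _ rest c tt (inj₂ jb)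
    classify _ _ rest (prev {A′} (old ia)) none c     = keep-all (A′ ++ _) [] rest c (lastOK-snoc A′ ia) tt
    classify _ _ rest (prev {A′} (new _ ja)) none c   = swap-all (A′ ++ _) [] rest c (lastOK-snoc A′ (inj₂ ja)) tt
    classify _ _ rest (prev {A′} (old ia)) (next (old ib)) c =
      keep-all (A′ ++ _) _ rest c (lastOK-snoc A′ ia) ib
    classify _ _ rest (prev {A′} (new _ ja)) (next (new _ jb)) c =
      swap-all (A′ ++ _) _ rest c (lastOK-snoc A′ (inj₂ ja)) (inj₂ jb)
    classify _ _ rest (prev {A′} {a} (old ia)) (next {b} {B′} (new _ jb)) c with a ≟ j
    ... | yes a≡j = swap-all (A′ ++ [ a ]) (b ∷ B′) rest c (lastOK-snoc A′ (inj₁ a≡j)) (inj₂ jb)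
    ... | no a≢j  = Surgery.impossible (reverse B′) b a (reverse A′) rest (reverse-i-path A′ a b B′ rest c) jb ia a≢j
    classify _ _ rest (prev {A′} {a} (new _ ja)) (next {b} {B′} (old ib)) c with b ≟ j
    ... | yes b≡j = swap-all (A′ ++ [ a ]) (b ∷ B′) rest c (lastOK-snoc A′ (inj₂ ja)) (inj₁ b≡j)
    ... | no b≢j  = Surgery.impossible A′ a b B′ rest c ja ib b≢j

    no-S-cover : ∀ {ps} → PathCover k S ps → ⊥
    no-S-cover {ps} c with focus ps (spanning c i)
    ... | Q , rest , p , i∈Q with ∈-∃++ i∈Q
    ...   | A , B , refl = classify A B rest (left-end A (initLast A) left) (right-end right) c′
      where
      c′ : PathCover k S ((A ++ i ∷ B) ∷ rest)
      c′ = reorder p c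
      open Around-i A B rest c′

-- The argument needs adjacency to i to be decidable; as the goal is a
-- negation, that may be assumed (double-negation shift over [n]).
lemma2p1 : (n k : ℕ) (G : Graph n) (i j : Fin n) → i < j →
    LFree k (Adj G) → LFree k (ShiftAdj G i j)
lemma2p1 n k G i j i<j free F size copy =
  ¬¬-shift n (λ z → ¬¬-excluded-middle) λ adj? →
    let open Shifted G i j (<⇒≢ i<j) adj? in
    no-S-cover free (proj₂ (copy⇒cover F size copy))
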